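{- Assume the abc conjecture holds. For any fixed positive integers $r$ and $k$, there are only finitely many positive integers $n$ such that $(n!)^r+k$ is powerful.
   Context: For a positive integer $n$, $\mathrm{rad}(n)$ denotes the product of the distinct primes dividing $n$. The abc conjecture states: for every real $\epsilon>0$ there are only finitely many triples $(a,b,c)$ of coprime positive integers with $a+b=c$ and $c>(\mathrm{rad}(abc))^{1+\epsilon}$. A positive integer $z$ is powerful if $p^2\mid z$ for every prime $p$ with $p\mid z$. -}

module Defs where

open import Data.Nat using (ℕ; suc; _*_; _^_; _+_; _<_; _≤_)
open import Data.Nat.Divisibility using (_∣_; _∣?_)
open import Data.Nat.Primality using (Prime; prime?)
open import Data.Nat.Coprimality using (Coprime)
open import Data.List using (List; filter; upTo; map)
open import Data.Nat.ListAction using (product)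
open import Relation.Binary.PropositionalEquality using (_≡_)
open import Data.Product using (_×_; ∃)
open import Relation.Nullary using (_×-dec_)

-- The primes p with p ≤ n and p ∣ n (each listed once), for n ≥ 1.
primeDivisors : ℕ → List ℕ
primeDivisors n = filter (λ p → prime? p ×-dec (p ∣? n)) (map suc (upTo n))

rad : ℕ → ℕ
rad n = product (primeDivisors n)

Powerful : ℕ → Set
Powerful z = ∀ p → Prime p → p ∣ z → p ^ 2 ∣ z

-- (a,b,c) is an abc triple of quality exceeding 1 + ε, where ε = e / d
-- (e, d ≥ 1):  c > rad(abc)^(1+e/d)  ⇔  c^d > rad(abc)^(d+e).
ExceptionalTriple : ℕ → ℕ → ℕ → ℕ → ℕ → Set
ExceptionalTriple e d a b c =
  1 ≤ a × 1 ≤ b × Coprime a b × a + b ≡ c × rad (a * b * c) ^ (d + e) < c ^ d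

-- abc conjecture: for every rational ε = e/d > 0 there are only finitely many
-- exceptional triples (finitely many ⇔ c bounded, since a, b < c).
ABC : Set
ABC = ∀ e d → 1 ≤ e → 1 ≤ d →
  ∃ λ N → ∀ a b c → ExceptionalTriple e d a b c → c ≤ N

{-# OPTIONS --safe #-}
module Submission where

-- Write M = (n!)^r + k = c g with g = gcd ((n!)^r, k), a = (n!)^r / g, b = k / g
-- and c = a + b.  Every prime factor of a is at most n, so (when it is not 2
-- or 3) it divides F = ∏_{s<t} (6s+1)(6s+5) with 6t ≤ n + 6; as F³ ≤ (6t)! this
-- gives F ≤ (poly(n) · n!)^{1/3}.  Prime factors of b divide k, prime factors of
-- c divide M, and rad(M)² ≤ M because M is powerful.  Altogether
-- rad(abc) ≤ 6 k F rad(M) ≤ poly(n) · M^{5/6}, while c ≥ M / k, so for large n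
-- the triple (a, b, c) has quality above 1 + 1/11.  The abc conjecture then
-- bounds c, hence M, hence n.

open import Defs
open import Data.Nat
open import Data.Nat.Properties
open import Data.Nat.Divisibility
open import Data.Nat.DivMod
open import Data.Nat.GCD using (gcd; gcd[m,n]∣m; gcd[m,n]∣n; gcd[m,n]≢0)
open import Data.Nat.Coprimality using (Coprime; coprime-/gcd)
open import Data.Nat.Primality
open import Data.Nat.ListAction using (product)
open import Data.Nat.ListAction.Properties using (∈⇒∣product)
open import Data.Nat.Tactic.RingSolver using (solve-∀)
open import Algebra.Properties.CommutativeSemigroup *-commutativeSemigroup 
  using (interchange; x∙yz≈y∙xz; x∙yz≈xz∙y; xy∙z≈xz∙y)
open import Data.List using ([]; _∷_; map; upTo)
open import Data.List.Membership.Propositional using (_∈_)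
open import Data.List.Membership.Propositional.Properties
  using (∈-filter⁻; ∈-filter⁺; ∈-map⁺; ∈-upTo⁺)
open import Data.List.Relation.Unary.All using (All; []; _∷_; tabulate)
open import Data.List.Relation.Unary.All.Properties using (All¬⇒¬Any)
open import Data.List.Relation.Unary.Any using (here; there)
open import Data.List.Relation.Unary.AllPairs using (_∷_)
open import Data.List.Relation.Unary.Unique.Propositional using (Unique)
import Data.List.Relation.Unary.Unique.Propositional.Properties as Unique
open import Data.Empty using (⊥-elim)
open import Data.Product using (_×_; _,_; proj₁; proj₂; ∃; ∃₂)
open import Data.Sum using (inj₁; inj₂)
open import Data.Unit using (tt)
open import Function using (_∘_)
open import Relation.Nullary using (¬_; yes; no; _×-dec_)
open import Relation.Nullary.Decidable using (toWitness)
open import Relation.Binary.PropositionalEquality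

^-distribʳ-* : ∀ m n j → (m * n) ^ j ≡ m ^ j * n ^ j
^-distribʳ-* m n zero    = refl
^-distribʳ-* m n (suc j) = begin
  m * n * (m * n) ^ j        ≡⟨ cong (m * n *_) (^-distribʳ-* m n j) ⟩
  m * n * (m ^ j * n ^ j)    ≡⟨ interchange m n (m ^ j) (n ^ j) ⟩
  m * m ^ j * (n * n ^ j)    ∎
  where open ≡-Reasoning

n≤n! : ∀ {n} → 1 ≤ n → n ≤ n !
n≤n! {suc n} _ = subst (_≤ suc n * n !) (*-identityʳ (suc n)) (*-monoʳ-≤ (suc n) (1≤n! n))

m≤n⇒m!≤n! : ∀ {m n} → m ≤ n → m ! ≤ n !
m≤n⇒m!≤n! {n = n} m≤n = ∣⇒≤ {{n !≢0}} (m≤n⇒m!∣n! m≤n)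

[m+n]!≤[m+n]^m*n! : ∀ m n → (m + n) ! ≤ (m + n) ^ m * n !
[m+n]!≤[m+n]^m*n! zero    n = ≤-reflexive (sym (+-identityʳ (n !)))
[m+n]!≤[m+n]^m*n! (suc m) n = begin
  suc (m + n) * (m + n) !               ≤⟨ *-monoʳ-≤ (suc (m + n)) ([m+n]!≤[m+n]^m*n! m n) ⟩
  suc (m + n) * ((m + n) ^ m * n !)     ≤⟨ *-monoʳ-≤ (suc (m + n)) (*-monoˡ-≤ (n !) (^-monoˡ-≤ m (n≤1+n (m + n)))) ⟩
  suc (m + n) * (suc (m + n) ^ m * n !) ≡⟨ sym (*-assoc (suc (m + n)) (suc (m + n) ^ m) (n !)) ⟩
  suc (m + n) * suc (m + n) ^ m * n !   ∎
  where open ≤-Reasoning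

prime[3] : Prime 3
prime[3] = toWitness {a? = prime? 3} tt

prime⇒2≤ : ∀ {p} → Prime p → 2 ≤ p
prime⇒2≤ {p} pp = nonTrivial⇒n>1 p {{prime⇒nonTrivial pp}}

prime∤1 : ∀ {p} → Prime p → ¬ p ∣ 1
prime∤1 pp p∣1 = <⇒≱ (prime⇒2≤ pp) (∣⇒≤ p∣1)

prime∣prime⇒≡ : ∀ {p q} → Prime p → Prime q → p ∣ q → p ≡ q
prime∣prime⇒≡ pp pq p∣q with prime⇒irreducible pq p∣q
... | inj₁ refl = ⊥-elim (prime∤1 pp ∣-refl)
... | inj₂ p≡q  = p≡q

prime∣m^j⇒∣m : ∀ {p m} j → Prime p → p ∣ m ^ j → p ∣ m
prime∣m^j⇒∣m zero    pp p∣1 = ⊥-elim (prime∤1 pp p∣1)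
prime∣m^j⇒∣m {m = m} (suc j) pp p∣ with euclidsLemma m (m ^ j) pp p∣
... | inj₁ p∣m   = p∣m
... | inj₂ p∣m^j = prime∣m^j⇒∣m j pp p∣m^j

prime∣n!⇒≤n : ∀ {p} n → Prime p → p ∣ n ! → p ≤ n
prime∣n!⇒≤n zero    pp p∣1 = ⊥-elim (prime∤1 pp p∣1)
prime∣n!⇒≤n (suc n) pp p∣ with euclidsLemma (suc n) (n !) pp p∣
... | inj₁ p∣1+n = ∣⇒≤ p∣1+n
... | inj₂ p∣n!  = m≤n⇒m≤1+n (prime∣n!⇒≤n n pp p∣n!)

prime∣product⇒∈ : ∀ {p qs} → Prime p → All Prime qs → p ∣ product qs → p ∈ qs
prime∣product⇒∈ pp [] p∣1 = ⊥-elim (prime∤1 pp p∣1)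
prime∣product⇒∈ {qs = q ∷ qs} pp (pq ∷ pqs) p∣ with euclidsLemma q (product qs) pp p∣
... | inj₁ p∣q  = here (prime∣prime⇒≡ pp pq p∣q)
... | inj₂ p∣qs = there (prime∣product⇒∈ pp pqs p∣qs)

p^j∣m*n∧p∤m⇒p^j∣n : ∀ {p m n} j → Prime p → ¬ p ∣ m → p ^ j ∣ m * n → p ^ j ∣ n
p^j∣m*n∧p∤m⇒p^j∣n zero pp p∤m _ = 1∣ _
p^j∣m*n∧p∤m⇒p^j∣n {p} {m} {n} (suc j) pp p∤m p^j+1∣mn
  with euclidsLemma m n pp (∣-trans (m∣m*n (p ^ j)) p^j+1∣mn)
... | inj₁ p∣m = ⊥-elim (p∤m p∣m)
... | inj₂ (divides n′ refl) = subst (p * p ^ j ∣_) (*-comm p n′) (*-monoʳ-∣ p p^j∣n′)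
  where
  instance _ = prime⇒nonZero pp
  shuffle : m * (n′ * p) ≡ p * (m * n′)
  shuffle = trans (cong (m *_) (*-comm n′ p)) (x∙yz≈y∙xz m p n′)
  p^j∣n′ : p ^ j ∣ n′
  p^j∣n′ = p^j∣m*n∧p∤m⇒p^j∣n j pp p∤m (*-cancelˡ-∣ p (subst (p * p ^ j ∣_) shuffle p^j+1∣mn))

p^j*m∣n : ∀ {p m n} j → Prime p → ¬ p ∣ m → p ^ j ∣ n → m ∣ n → p ^ j * m ∣ n
p^j*m∣n {p} {m} j pp p∤m p^j∣n (divides q refl) =
  *-monoˡ-∣ m (p^j∣m*n∧p∤m⇒p^j∣n j pp p∤m (subst (p ^ j ∣_) (*-comm q m) p^j∣n))

product^∣ : ∀ {n} j {ps} → Unique ps → All Prime ps → All (λ p → p ^ j ∣ n) ps →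
            product ps ^ j ∣ n
product^∣ {n} j {[]} _ _ _ = subst (_∣ n) (sym (^-zeroˡ j)) (1∣ n)
product^∣ {n} j {p ∷ ps} (p∉ps ∷ ps!) (pp ∷ pps) (p^j∣n ∷ ps^j∣n) =
  subst (_∣ n) (sym (^-distribʳ-* p (product ps) j))
    (p^j*m∣n j pp p∤ps^j p^j∣n (product^∣ j ps! pps ps^j∣n))
  where
  p∤ps^j : ¬ p ∣ product ps ^ j
  p∤ps^j = All¬⇒¬Any p∉ps ∘ prime∣product⇒∈ pp pps ∘ prime∣m^j⇒∣m j pp

∈primeDivisors⁻ : ∀ {m p} → p ∈ primeDivisors m → Prime p × p ∣ m
∈primeDivisors⁻ {m} = proj₂ ∘ ∈-filter⁻ (λ q → prime? q ×-dec (q ∣? m)) {xs = map suc (upTo m)}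

∈primeDivisors⁺ : ∀ {m p} → .{{NonZero m}} → Prime p → p ∣ m → p ∈ primeDivisors m
∈primeDivisors⁺ {m} {p} pp p∣m =
  ∈-filter⁺ (λ q → prime? q ×-dec (q ∣? m)) (∈[1,m] (<⇒≤ (prime⇒2≤ pp)) (∣⇒≤ p∣m)) (pp , p∣m)
  where
  ∈[1,m] : ∀ {q} → 1 ≤ q → q ≤ m → q ∈ map suc (upTo m)
  ∈[1,m] {suc q} _ q<m = ∈-map⁺ suc (∈-upTo⁺ q<m)

primeDivisors-unique : ∀ m → Unique (primeDivisors m)
primeDivisors-unique m =
  Unique.filter⁺ (λ q → prime? q ×-dec (q ∣? m)) (Unique.map⁺ suc-injective (Unique.upTo⁺ m))

primeDivisors-prime : ∀ m → All Prime (primeDivisors m)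
primeDivisors-prime m = tabulate (proj₁ ∘ ∈primeDivisors⁻ {m})

rad≢0 : ∀ m → NonZero (rad m)
rad≢0 m = productOfPrimes≢0 (primeDivisors-prime m)

prime∣m⇒∣rad : ∀ {m p} → .{{NonZero m}} → Prime p → p ∣ m → p ∣ rad m
prime∣m⇒∣rad pp p∣m = ∈⇒∣product (∈primeDivisors⁺ pp p∣m)

rad^∣ : ∀ m {n} j → (∀ p → Prime p → p ∣ m → p ^ j ∣ n) → rad m ^ j ∣ n
rad^∣ m j h = product^∣ j (primeDivisors-unique m) (primeDivisors-prime m)
  (tabulate (λ p∈ → let (pp , p∣m) = ∈primeDivisors⁻ p∈ in h _ pp p∣m))

rad≤ : ∀ m {n} → .{{NonZero n}} → (∀ p → Prime p → p ∣ m → p ∣ n) → rad m ≤ n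
rad≤ m {n} h = ∣⇒≤ (subst (_∣ n) (^-identityʳ (rad m))
  (rad^∣ m 1 λ p pp p∣m → subst (_∣ n) (sym (^-identityʳ p)) (h p pp p∣m)))

powerful⇒rad^2≤ : ∀ {z} → .{{NonZero z}} → Powerful z → rad z ^ 2 ≤ z
powerful⇒rad^2≤ {z} pw = ∣⇒≤ (rad^∣ z 2 pw)

coprime6Factorial : ℕ → ℕ
coprime6Factorial zero    = 1
coprime6Factorial (suc t) = coprime6Factorial t * ((1 + t * 6) * (5 + t * 6))

coprime6Factorial≢0 : ∀ t → NonZero (coprime6Factorial t)
coprime6Factorial≢0 zero    = _
coprime6Factorial≢0 (suc t) = m*n≢0 _ _ {{coprime6Factorial≢0 t}}

[1+6s][5+6s]∣coprime6Factorial : ∀ {s t} → s < t →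
  (1 + s * 6) * (5 + s * 6) ∣ coprime6Factorial t
[1+6s][5+6s]∣coprime6Factorial {s} {suc t} s<1+t with m≤n⇒m<n∨m≡n (s≤s⁻¹ s<1+t)
... | inj₁ s<t  = ∣m⇒∣m*n _ ([1+6s][5+6s]∣coprime6Factorial s<t)
... | inj₂ refl = n∣m*n (coprime6Factorial s)

prime∣6*coprime6Factorial : ∀ {p t} → Prime p → p < t * 6 → p ∣ 6 * coprime6Factorial t
prime∣6*coprime6Factorial {p} {t} pp p<6t = byResidue (p % 6) (m≡m%n+[m/n]*n p 6) (m%n<n p 6)
  where
  F = coprime6Factorial t
  s = p / 6
  factor∣F : (1 + s * 6) * (5 + s * 6) ∣ F
  factor∣F = [1+6s][5+6s]∣coprime6Factorial (m<n*o⇒m/o<n {n = t} p<6t)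
  via6 : ∀ {q ρ} → Prime q → q ∣ 6 → q ∣ ρ → p ≡ ρ + s * 6 → p ∣ 6 * F
  via6 {q} pq q∣6 q∣ρ p≡ = subst (_∣ 6 * F) (prime∣prime⇒≡ pq pp q∣p) (∣m⇒∣m*n F q∣6)
    where
    q∣p : q ∣ p
    q∣p = subst (q ∣_) (sym p≡) (∣m∣n⇒∣m+n q∣ρ (∣n⇒∣m*n s q∣6))
  viaF : ∀ {d} → p ≡ d → d ∣ F → p ∣ 6 * F
  viaF refl d∣F = ∣n⇒∣m*n 6 d∣F
  byResidue : ∀ ρ → p ≡ ρ + s * 6 → ρ < 6 → p ∣ 6 * F
  byResidue 0 p≡ _ = via6 prime[2] (divides 3 refl) (divides 0 refl) p≡
  byResidue 1 p≡ _ = viaF p≡ (m*n∣⇒m∣ _ _ factor∣F)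
  byResidue 2 p≡ _ = via6 prime[2] (divides 3 refl) (divides 1 refl) p≡
  byResidue 3 p≡ _ = via6 prime[3] (divides 2 refl) (divides 1 refl) p≡
  byResidue 4 p≡ _ = via6 prime[2] (divides 3 refl) (divides 2 refl) p≡
  byResidue 5 p≡ _ = viaF p≡ (m*n∣⇒n∣ (1 + s * 6) _ factor∣F)
  byResidue (suc (suc (suc (suc (suc (suc _)))))) _ (s≤s (s≤s (s≤s (s≤s (s≤s (s≤s ()))))))

[1+x][5+x]^3*x!≤[6+x]! : ∀ x → ((1 + x) * (5 + x)) ^ 3 * x ! ≤ (6 + x) !
[1+x][5+x]^3*x!≤[6+x]! x = begin
  q * (q * (q * 1)) * x !                                     ≤⟨ *-monoˡ-≤ (x !) (*-monoʳ-≤ q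
                                                                 (*-mono-≤ q≤[2+x][4+x] (*-monoˡ-≤ 1 q≤[3+x][6+x]))) ⟩
  q * ((2 + x) * (4 + x) * ((3 + x) * (6 + x) * 1)) * x !     ≡⟨ regroup x (x !) ⟩
  (6 + x) !                                                   ∎
  where
  open ≤-Reasoning
  q = (1 + x) * (5 + x)
  [2+x][4+x]≡3+q : ∀ x → (2 + x) * (4 + x) ≡ 3 + (1 + x) * (5 + x)
  [2+x][4+x]≡3+q = solve-∀
  q≤[2+x][4+x] : q ≤ (2 + x) * (4 + x)
  q≤[2+x][4+x] = subst (q ≤_) (sym ([2+x][4+x]≡3+q x)) (m≤n+m q 3)
  q≤[3+x][6+x] : q ≤ (3 + x) * (6 + x)
  q≤[3+x][6+x] = *-mono-≤ (+-monoˡ-≤ x {1} {3} (s≤s z≤n)) (n≤1+n (5 + x))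
  regroup : ∀ x y → (1 + x) * (5 + x) * ((2 + x) * (4 + x) * ((3 + x) * (6 + x) * 1)) * y
                  ≡ (6 + x) * ((5 + x) * ((4 + x) * ((3 + x) * ((2 + x) * ((1 + x) * y)))))
  regroup = solve-∀

coprime6Factorial^3≤[6t]! : ∀ t → coprime6Factorial t ^ 3 ≤ (t * 6) !
coprime6Factorial^3≤[6t]! zero    = ≤-refl
coprime6Factorial^3≤[6t]! (suc t) = begin
  (F * q) ^ 3         ≡⟨ ^-distribʳ-* F q 3 ⟩
  F ^ 3 * q ^ 3       ≤⟨ *-monoˡ-≤ (q ^ 3) (coprime6Factorial^3≤[6t]! t) ⟩
  (t * 6) ! * q ^ 3   ≡⟨ *-comm ((t * 6) !) (q ^ 3) ⟩
  q ^ 3 * (t * 6) !   ≤⟨ [1+x][5+x]^3*x!≤[6+x]! (t * 6) ⟩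
  (6 + t * 6) !       ∎
  where
  open ≤-Reasoning
  F = coprime6Factorial t
  q = (1 + t * 6) * (5 + t * 6)

-- With t = ⌊n/6⌋ + 1 we have n < 6t ≤ n + 6.
prime∣n!⇒∣6*coprime6Factorial : ∀ {p} n → Prime p → p ∣ n ! →
  p ∣ 6 * coprime6Factorial (suc (n / 6))
prime∣n!⇒∣6*coprime6Factorial n pp p∣n! =
  prime∣6*coprime6Factorial {t = suc (n / 6)} pp (≤-<-trans (prime∣n!⇒≤n n pp p∣n!) n<6t)
  where
  n<6t : n < 6 + n / 6 * 6
  n<6t = subst (_< 6 + n / 6 * 6) (sym (m≡m%n+[m/n]*n n 6)) (+-monoˡ-< (n / 6 * 6) (m%n<n n 6))

coprime6Factorial^3≤poly*n! : ∀ n → coprime6Factorial (suc (n / 6)) ^ 3 ≤ (6 + n) ^ 6 * n !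
coprime6Factorial^3≤poly*n! n = begin
  coprime6Factorial (suc (n / 6)) ^ 3   ≤⟨ coprime6Factorial^3≤[6t]! (suc (n / 6)) ⟩
  (6 + n / 6 * 6) !                     ≤⟨ m≤n⇒m!≤n! (+-monoʳ-≤ 6 (m/n*n≤m n 6)) ⟩
  (6 + n) !                             ≤⟨ [m+n]!≤[m+n]^m*n! 6 n ⟩
  (6 + n) ^ 6 * n !                     ∎
  where open ≤-Reasoning

n<2^n : ∀ n → n < 2 ^ n
n<2^n zero    = s≤s z≤n
n<2^n (suc n) = begin-strict
  suc n           <⟨ s≤s (n<2^n n) ⟩
  suc (2 ^ n)     ≡⟨ +-comm 1 (2 ^ n) ⟩
  2 ^ n + 1       ≤⟨ +-monoʳ-≤ (2 ^ n) (m^n>0 2 n) ⟩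
  2 ^ n + 2 ^ n   ≡⟨ cong (2 ^ n +_) (sym (+-identityʳ (2 ^ n))) ⟩
  2 ^ suc n       ∎
  where open ≤-Reasoning

m^n≤[n+m]! : ∀ m n → m ^ n ≤ (n + m) !
m^n≤[n+m]! m zero    = 1≤n! m
m^n≤[n+m]! m (suc n) = *-mono-≤ (≤-trans (m≤n+m m n) (n≤1+n (n + m))) (m^n≤[n+m]! m n)

-- Beyond n = 2B + C·B^{2B}, write n = j + 2B: then C·B^n ≤ j·B^j < (2B)^j ≤ n!.
exp<factorial : ∀ C B → .{{NonZero B}} → ∃ λ N → ∀ n → N ≤ n → C * B ^ n < n !
exp<factorial C B = 2 * B + K , bound
  where
  K = C * B ^ (2 * B)
  bound : ∀ n → 2 * B + K ≤ n → C * B ^ n < n !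
  bound n N≤n = begin-strict
    C * B ^ n                  ≡⟨ cong (λ i → C * B ^ i) (sym j+2B≡n) ⟩
    C * B ^ (j + 2 * B)        ≡⟨ cong (C *_) (^-distribˡ-+-* B j (2 * B)) ⟩
    C * (B ^ j * B ^ (2 * B))  ≡⟨ x∙yz≈xz∙y C (B ^ j) (B ^ (2 * B)) ⟩
    K * B ^ j                  ≤⟨ *-monoˡ-≤ (B ^ j) K≤j ⟩
    j * B ^ j                  <⟨ *-monoˡ-< (B ^ j) {{m^n≢0 B j}} (n<2^n j) ⟩
    2 ^ j * B ^ j              ≡⟨ sym (^-distribʳ-* 2 B j) ⟩
    (2 * B) ^ j                ≤⟨ m^n≤[n+m]! (2 * B) j ⟩
    (j + 2 * B) !              ≡⟨ cong _! j+2B≡n ⟩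
    n !                        ∎
    where
    open ≤-Reasoning
    j = n ∸ 2 * B
    j+2B≡n : j + 2 * B ≡ n
    j+2B≡n = m∸n+n≡m (≤-trans (m≤m+n (2 * B) K) N≤n)
    K≤j : K ≤ j
    K≤j = subst (_≤ j) (m+n∸m≡n (2 * B) K) (∸-monoˡ-≤ (2 * B) N≤n)

[a+n]^e≤2^[a*e]*[2^e]^n : ∀ a e n → (a + n) ^ e ≤ 2 ^ (a * e) * (2 ^ e) ^ n
[a+n]^e≤2^[a*e]*[2^e]^n a e n = begin
  (a + n) ^ e                 ≤⟨ ^-monoˡ-≤ e (<⇒≤ (n<2^n (a + n))) ⟩
  (2 ^ (a + n)) ^ e           ≡⟨ ^-*-assoc 2 (a + n) e ⟩
  2 ^ ((a + n) * e)           ≡⟨ cong (2 ^_) (*-distribʳ-+ e a n) ⟩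
  2 ^ (a * e + n * e)         ≡⟨ ^-distribˡ-+-* 2 (a * e) (n * e) ⟩
  2 ^ (a * e) * 2 ^ (n * e)   ≡⟨ cong (λ i → 2 ^ (a * e) * 2 ^ i) (*-comm n e) ⟩
  2 ^ (a * e) * 2 ^ (e * n)   ≡⟨ cong (2 ^ (a * e) *_) (sym (^-*-assoc 2 e n)) ⟩
  2 ^ (a * e) * (2 ^ e) ^ n   ∎
  where open ≤-Reasoning

-- Opaque: the threshold is astronomically large and must never be unfolded by the type checker.
opaque
  poly<factorial : ∀ C a b e → ∃ λ N → ∀ n → N ≤ n → C * ((a + n) ^ b) ^ e < n !
  poly<factorial C a b e with exp<factorial (C * 2 ^ (a * (b * e))) (2 ^ (b * e)) {{m^n≢0 2 (b * e)}}
  ... | N , bound = N , λ n N≤n → begin-strict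
    C * ((a + n) ^ b) ^ e                           ≡⟨ cong (C *_) (^-*-assoc (a + n) b e) ⟩
    C * (a + n) ^ (b * e)                           ≤⟨ *-monoʳ-≤ C ([a+n]^e≤2^[a*e]*[2^e]^n a (b * e) n) ⟩
    C * (2 ^ (a * (b * e)) * (2 ^ (b * e)) ^ n)     ≡⟨ sym (*-assoc C (2 ^ (a * (b * e))) ((2 ^ (b * e)) ^ n)) ⟩
    C * 2 ^ (a * (b * e)) * (2 ^ (b * e)) ^ n       <⟨ bound n N≤n ⟩
    n !                                             ∎
    where open ≤-Reasoning

-- ρ ≲ X^{1/3} M^{1/2} gives ρ¹² ≲ X⁴ M⁶; the spare factor X in M¹¹ ≥ X⁵ M⁶ absorbs the constants.
ρ^12<c^11 : ∀ {ρ k F R M X c W} →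
  ρ ≤ 6 * F * k * R → F ^ 3 ≤ W * X → R ^ 2 ≤ M → X ≤ M → M ≤ c * k →
  (6 * k) ^ 12 * k ^ 11 * W ^ 4 < X → ρ ^ 12 < c ^ 11
ρ^12<c^11 {ρ} {k} {F} {R} {M} {X} {c} {W} ρ≤ F^3≤ R^2≤ X≤M M≤ck large =
  *-cancelʳ-< (k ^ 11) (ρ ^ 12) (c ^ 11) (begin-strict
    ρ ^ 12 * k ^ 11                                ≤⟨ *-monoˡ-≤ (k ^ 11) ρ^12≤ ⟩
    (6 * k) ^ 12 * (W ^ 4 * X ^ 4) * M ^ 6 * k ^ 11 ≡⟨ regroup ((6 * k) ^ 12) (W ^ 4) (X ^ 4) (M ^ 6) (k ^ 11) ⟩
    (6 * k) ^ 12 * k ^ 11 * W ^ 4 * (X ^ 4 * M ^ 6) <⟨ *-monoˡ-< (X ^ 4 * M ^ 6) {{X⁴M⁶≢0}} large ⟩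
    X * (X ^ 4 * M ^ 6)                            ≡⟨ sym (*-assoc X (X ^ 4) (M ^ 6)) ⟩
    X ^ 5 * M ^ 6                                  ≤⟨ *-monoˡ-≤ (M ^ 6) (^-monoˡ-≤ 5 X≤M) ⟩
    M ^ 5 * M ^ 6                                  ≡⟨ sym (^-distribˡ-+-* M 5 6) ⟩
    M ^ 11                                         ≤⟨ ^-monoˡ-≤ 11 M≤ck ⟩
    (c * k) ^ 11                                   ≡⟨ ^-distribʳ-* c k 11 ⟩
    c ^ 11 * k ^ 11                                ∎)
  where
  open ≤-Reasoning
  X≢0 : NonZero X
  X≢0 = >-nonZero (≤-trans (s≤s z≤n) large)
  X⁴M⁶≢0 : NonZero (X ^ 4 * M ^ 6)
  X⁴M⁶≢0 = m*n≢0 _ _ {{m^n≢0 X 4 {{X≢0}}}} {{m^n≢0 M 6 {{>-nonZero (≤-trans (>-nonZero⁻¹ X {{X≢0}}) X≤M)}}}}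
  regroup : ∀ d w x m l → d * (w * x) * m * l ≡ d * l * w * (x * m)
  regroup = solve-∀
  ρ^12≤ : ρ ^ 12 ≤ (6 * k) ^ 12 * (W ^ 4 * X ^ 4) * M ^ 6
  ρ^12≤ = begin
    ρ ^ 12                                   ≤⟨ ^-monoˡ-≤ 12 (subst (ρ ≤_) (cong (_* R) (xy∙z≈xz∙y 6 F k)) ρ≤) ⟩
    (6 * k * F * R) ^ 12                     ≡⟨ ^-distribʳ-* (6 * k * F) R 12 ⟩
    (6 * k * F) ^ 12 * R ^ 12                ≡⟨ cong (_* R ^ 12) (^-distribʳ-* (6 * k) F 12) ⟩
    (6 * k) ^ 12 * F ^ 12 * R ^ 12           ≤⟨ *-mono-≤ (*-monoʳ-≤ ((6 * k) ^ 12) F^12≤) R^12≤ ⟩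
    (6 * k) ^ 12 * (W * X) ^ 4 * M ^ 6       ≡⟨ cong (λ v → (6 * k) ^ 12 * v * M ^ 6) (^-distribʳ-* W X 4) ⟩
    (6 * k) ^ 12 * (W ^ 4 * X ^ 4) * M ^ 6   ∎
    where
    F^12≤ : F ^ 12 ≤ (W * X) ^ 4
    F^12≤ = subst (_≤ (W * X) ^ 4) (^-*-assoc F 3 4) (^-monoˡ-≤ 4 F^3≤)
    R^12≤ : R ^ 12 ≤ M ^ 6
    R^12≤ = subst (_≤ M ^ 6) (^-*-assoc R 2 6) (^-monoˡ-≤ 6 R^2≤)

coprimeSplitting : ∀ m n → .{{NonZero n}} →
  ∃₂ λ a b → ∃ λ g → Coprime a b × a * g ≡ m × b * g ≡ n
coprimeSplitting m n =
  m / g , n / g , g , coprime-/gcd m n , m/n*n≡m (gcd[m,n]∣m m n) , m/n*n≡m (gcd[m,n]∣n m n)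
  where
  g = gcd m n
  instance
    g≢0 : NonZero g
    g≢0 = ≢-nonZero (gcd[m,n]≢0 m n (inj₂ (≢-nonZero⁻¹ n)))

m*n≡o⇒1≤m : ∀ {m n o} → .{{NonZero o}} → m * n ≡ o → 1 ≤ m
m*n≡o⇒1≤m {suc m} _ = s≤s z≤n
m*n≡o⇒1≤m {zero} {o = suc o} ()

rad[a*b*c]≤6*F*k*rad[M] : ∀ {k a b c M} n r → .{{NonZero k}} → .{{NonZero M}} →
  a ∣ (n !) ^ r → b ∣ k → c ∣ M → rad (a * b * c) ≤ 6 * coprime6Factorial (suc (n / 6)) * k * rad M
rad[a*b*c]≤6*F*k*rad[M] {k} {a} {b} {c} {M} n r a∣P b∣k c∣M =
  rad≤ (a * b * c) route
  where
  F = coprime6Factorial (suc (n / 6))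
  instance
    6Fk·radM≢0 : NonZero (6 * F * k * rad M)
    6Fk·radM≢0 = m*n≢0 _ _ {{m*n≢0 _ _ {{m*n≢0 6 F {{_}} {{coprime6Factorial≢0 (suc (n / 6))}}}}}} {{rad≢0 M}}
  route : ∀ p → Prime p → p ∣ a * b * c → p ∣ 6 * F * k * rad M
  route p pp p∣abc with euclidsLemma (a * b) c pp p∣abc
  ... | inj₂ p∣c = ∣n⇒∣m*n (6 * F * k) (prime∣m⇒∣rad pp (∣-trans p∣c c∣M))
  ... | inj₁ p∣ab with euclidsLemma a b pp p∣ab
  ...   | inj₁ p∣a = ∣m⇒∣m*n (rad M) (∣m⇒∣m*n k
                       (prime∣n!⇒∣6*coprime6Factorial n pp (prime∣m^j⇒∣m r pp (∣-trans p∣a a∣P))))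
  ...   | inj₂ p∣b = ∣m⇒∣m*n (rad M) (∣n⇒∣m*n (6 * F) (∣-trans p∣b b∣k))

powerful⇒exceptionalTriple : ∀ {n r k a b g} → 1 ≤ r → .{{NonZero k}} →
  Powerful ((n !) ^ r + k) → (6 * k) ^ 12 * k ^ 11 * ((6 + n) ^ 6) ^ 4 < n ! →
  Coprime a b → a * g ≡ (n !) ^ r → b * g ≡ k →
  ExceptionalTriple 1 11 a b (a + b) × n ! ≤ (a + b) * k
powerful⇒exceptionalTriple {n} {r} {k} {a} {b} {g} r≥1 pw large a⊥b a*g≡P b*g≡k =
  (m*n≡o⇒1≤m a*g≡P , m*n≡o⇒1≤m b*g≡k , a⊥b , refl ,
   ρ^12<c^11 {k = k} {F} {rad M} {M} {n !} {a + b} {(6 + n) ^ 6}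
     rad[abc]≤ (coprime6Factorial^3≤poly*n! n) (powerful⇒rad^2≤ pw) n!≤M M≤ck large) ,
  ≤-trans n!≤M M≤ck
  where
  P = (n !) ^ r
  M = P + k
  F = coprime6Factorial (suc (n / 6))
  instance
    P≢0 : NonZero P
    P≢0 = m^n≢0 (n !) r {{n !≢0}}
    M≢0 : NonZero M
    M≢0 = >-nonZero (≤-trans (>-nonZero⁻¹ P) (m≤m+n P k))
  c*g≡M : (a + b) * g ≡ M
  c*g≡M = trans (*-distribʳ-+ g a b) (cong₂ _+_ a*g≡P b*g≡k)
  n!≤M : n ! ≤ M
  n!≤M = ≤-trans (subst (_≤ P) (^-identityʳ (n !)) (^-monoʳ-≤ (n !) {{n !≢0}} r≥1)) (m≤m+n P k)
  M≤ck : M ≤ (a + b) * k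
  M≤ck = subst (_≤ (a + b) * k) c*g≡M (*-monoʳ-≤ (a + b) (∣⇒≤ (subst (g ∣_) b*g≡k (n∣m*n b))))
  rad[abc]≤ : rad (a * b * (a + b)) ≤ 6 * F * k * rad M
  rad[abc]≤ = rad[a*b*c]≤6*F*k*rad[M] n r (subst (a ∣_) a*g≡P (m∣m*n g))
    (subst (b ∣_) b*g≡k (m∣m*n g)) (subst (a + b ∣_) c*g≡M (m∣m*n g))

mainTheorem4 : ABC → ∀ r k → 1 ≤ r → 1 ≤ k →
    ∃ λ N → ∀ n → 1 ≤ n → Powerful ((n !) ^ r + k) → n ≤ N
mainTheorem4 abc r k r≥1 k≥1 = N₀ + C * k , n≤N₀+Ck
  where
  instance
    k≢0 : NonZero k
    k≢0 = >-nonZero k≥1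
  C : ℕ
  C = proj₁ (abc 1 11 ≤-refl (s≤s z≤n))
  c≤C : ∀ a b c → ExceptionalTriple 1 11 a b c → c ≤ C
  c≤C = proj₂ (abc 1 11 ≤-refl (s≤s z≤n))
  N₀ : ℕ
  N₀ = proj₁ (poly<factorial ((6 * k) ^ 12 * k ^ 11) 6 6 4)
  factorialWins : ∀ n → N₀ ≤ n → (6 * k) ^ 12 * k ^ 11 * ((6 + n) ^ 6) ^ 4 < n !
  factorialWins = proj₂ (poly<factorial ((6 * k) ^ 12 * k ^ 11) 6 6 4)
  n≤N₀+Ck : ∀ n → 1 ≤ n → Powerful ((n !) ^ r + k) → n ≤ N₀ + C * k
  n≤N₀+Ck n n≥1 pw with N₀ ≤? n
  ... | no N₀≰n = ≤-trans (<⇒≤ (≰⇒> N₀≰n)) (m≤m+n N₀ (C * k))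
  ... | yes N₀≤n =
    let a , b , g , a⊥b , a*g≡P , b*g≡k = coprimeSplitting ((n !) ^ r) k
        exceptional , n!≤ck =
          powerful⇒exceptionalTriple {n} {r} {k} {a} {b} {g} r≥1 pw (factorialWins n N₀≤n) a⊥b a*g≡P b*g≡k
    in begin
      n             ≤⟨ n≤n! n≥1 ⟩
      n !           ≤⟨ n!≤ck ⟩
      (a + b) * k   ≤⟨ *-monoˡ-≤ k (c≤C a b (a + b) exceptional) ⟩
      C * k         ≤⟨ m≤n+m (C * k) N₀ ⟩
      N₀ + C * k    ∎
    where open ≤-Reasoning
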